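{- Let $v,k_0,k,\lambda$ be integers with $v\ge 2$ such that $$k_0(k_0-1)+3k(k-1)=\lambda(v-1)\quad\text{and}\quad v=k_0+3k-\lambda .$$ Then the integer $1+2(k_0+3k)-3(k_0-k)^2$ is a perfect square.
   Context: These are the conditions for $(v;k_0,k,k,k;\lambda)$ to be the parameter set of a difference family $(X_0,X_1,X_2,X_3)$ in an abelian group of order $v$ with $|X_0|=k_0$, $|X_1|=|X_2|=|X_3|=k$, every nonzero group element arising as a difference $x-y$ with $x,y$ in a common block exactly $\lambda$ times in total, and with order $n=k_0+3k-\lambda$ equal to $v$ (Goethals–Seidel type). -}

module Defs where

{-# OPTIONS --safe #-}
module Submission where

-- Write s = k₀ + 3k. Once v = s − λ is substituted, the counting equation
-- k₀(k₀ − 1) + 3k(k − 1) = λ(v − 1) is quadratic in λ, and completing the square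
-- shows that its discriminant 1 + 2s − 3(k₀ − k)² equals (s − 2λ − 1)² = (2v − s − 1)².

open import Defs
open import Data.Integer using (ℤ; _+_; _-_; _*_; _≤_; +_)
open import Data.Integer.Properties using (+-inverseʳ; *-zeroʳ; +-identityʳ)
open import Data.Integer.Tactic.RingSolver using (solve-∀)
open import Data.Product using (∃; _,_)
open import Relation.Binary.PropositionalEquality using (_≡_; sym; cong; module ≡-Reasoning)

square-completion : ∀ k₀ k λ' →
  let s = k₀ + + 3 * k in
  (s - + 2 * λ' - + 1) * (s - + 2 * λ' - + 1)
  ≡ (+ 1 + + 2 * s - + 3 * ((k₀ - k) * (k₀ - k)))
    + + 4 * (k₀ * (k₀ - + 1) + + 3 * (k * (k - + 1)) - λ' * ((s - λ') - + 1))
square-completion = solve-∀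

x+c*[a-a]≡x : ∀ x c a → x + c * (a - a) ≡ x
x+c*[a-a]≡x x c a = begin
  x + c * (a - a) ≡⟨ cong (λ t → x + c * t) (+-inverseʳ a) ⟩
  x + c * + 0     ≡⟨ cong (λ t → x + t) (*-zeroʳ c) ⟩
  x + + 0         ≡⟨ +-identityʳ x ⟩
  x               ∎
  where open ≡-Reasoning

mainTheorem2 : (v k₀ k λ' : ℤ) →
    + 2 ≤ v →
    k₀ * (k₀ - + 1) + + 3 * (k * (k - + 1)) ≡ λ' * (v - + 1) →
    v ≡ k₀ + + 3 * k - λ' →
    ∃ λ (m : ℤ) → m * m ≡ + 1 + + 2 * (k₀ + + 3 * k) - + 3 * ((k₀ - k) * (k₀ - k))
mainTheorem2 v k₀ k λ' _ counting v≡s-λ = m , (begin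
  m * m                                              ≡⟨ square-completion k₀ k λ' ⟩
  discriminant + + 4 * (pairs - λ' * (s - λ' - + 1)) ≡⟨ cong (λ u → discriminant + + 4 * (pairs - λ' * (u - + 1))) (sym v≡s-λ) ⟩
  discriminant + + 4 * (pairs - differences)         ≡⟨ cong (λ t → discriminant + + 4 * (t - differences)) counting ⟩
  discriminant + + 4 * (differences - differences)   ≡⟨ x+c*[a-a]≡x discriminant (+ 4) differences ⟩
  discriminant                                       ∎)
  where
  open ≡-Reasoning
  s m pairs differences discriminant : ℤ
  s = k₀ + + 3 * k
  m = s - + 2 * λ' - + 1
  pairs = k₀ * (k₀ - + 1) + + 3 * (k * (k - + 1))
  differences = λ' * (v - + 1)
  discriminant = + 1 + + 2 * s - + 3 * ((k₀ - k) * (k₀ - k))
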